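{- Let $M$ be a matroid with tree-width $k$. If $(T,\tau)$ is a good tree-decomposition of $M$, then for every pair of subsets $U$ and $W$ of $E(M)$ displayed by an edge of $T$, neither $r(U)$ nor $r(W)$ is equal to $r(M)$.
   Context: A tree-decomposition of a matroid $M$ is a pair $(T,\tau)$ with $T$ a tree and $\tau:E(M)\to V(T)$ an arbitrary map. For a vertex $v$ of $T$, let $T_1,\dots,T_c$ be the components of $T-v$ and $B_j=\{e\in E(M):\tau(e)\in V(T_j)\}$. The rank defect of a set $B$ is $\mathrm{rd}(B)=r(M)-r(E(M)-B)$. The node width of $v$ is $r(M)-\sum_{j=1}^{c}\mathrm{rd}(B_j)$ (equal to $r(M)$ if $T$ has one vertex). The width of $(T,\tau)$ is the maximum node width over the vertices of $T$; the tree-width $\mathrm{tw}(M)$ is the minimum width over all tree-decompositions. $v(M)$ denotes the minimum of $|V(T)|$ over all tree-decompositions $(T,\tau)$ of $M$ of width $\mathrm{tw}(M)$; a tree-decomposition is good if its width is $\mathrm{tw}(M)$ and $|V(T)|=v(M)$. For an edge $e=uw$ of $T$, with $T_u,T_w$ the components of $T\setminus e$ containing $u,w$, the edge displays $U=\{x:\tau(x)\in V(T_u)\}$ and $W=\{x:\tau(x)\in V(T_w)\}$. -}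

module Defs where

open import Data.Nat using (ℕ; zero; suc; _+_; _∸_; _≤_; _⊔_)
open import Data.Bool using (Bool; true; false; _∧_; _∨_; not; if_then_else_)
open import Data.Fin using (Fin; _≟_; _<?_)
open import Data.Fin.Subset using (Subset; _∪_; _∩_; _⊆_; ∣_∣; ⁅_⁆; ∁) renaming (⊤ to Full)
open import Data.Vec using (Vec; tabulate; lookup)
open import Data.List using (List; []; _∷_; _++_; length; map; foldr; allFin)
open import Data.Nat.ListAction using (sum)
open import Data.List.Relation.Unary.Unique.Propositional using (Unique)
open import Data.Product using (Σ; ∃; _×_)
open import Data.Sum using (_⊎_)
open import Data.Unit using (⊤)
open import Data.Empty using (⊥)
open import Relation.Nullary using (¬_)
open import Relation.Nullary.Decidable using (⌊_⌋)
open import Relation.Binary.PropositionalEquality using (_≡_)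

record Matroid (n : ℕ) : Set where
  field
    r     : Subset n → ℕ
    R1    : ∀ X → r X ≤ ∣ X ∣
    R2    : ∀ X Y → X ⊆ Y → r X ≤ r Y
    R3    : ∀ X Y → r (X ∪ Y) + r (X ∩ Y) ≤ r X + r Y

rM : ∀ {n} → Matroid n → ℕ
rM M = Matroid.r M Full

-- rank defect rd(B) = r(M) - r(E(M) - B)   (nonnegative by R2)
rd : ∀ {n} → Matroid n → Subset n → ℕ
rd M B = rM M ∸ Matroid.r M (∁ B)

Adjacency : ℕ → Set
Adjacency m = Fin m → Fin m → Bool

Walk : ∀ {m} → Adjacency m → List (Fin m) → Set
Walk A []           = ⊤
Walk A (x ∷ [])     = ⊤
Walk A (x ∷ y ∷ xs) = A x y ≡ true × Walk A (y ∷ xs)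

Cycle : ∀ {m} → Adjacency m → List (Fin m) → Set
Cycle A []       = ⊥
Cycle A (x ∷ xs) = 2 ≤ length xs × Unique (x ∷ xs) × Walk A (x ∷ xs ++ x ∷ [])

record Tree : Set where
  field
    nV        : ℕ
    adj       : Adjacency nV
    nonempty  : 1 ≤ nV
    symmetric : ∀ a b → adj a b ≡ adj b a
    irreflex  : ∀ a → adj a a ≡ false
    connected : ∀ a b → a ≡ b ⊎ ∃ (λ xs → Walk adj (a ∷ xs ++ b ∷ []))
    acyclic   : ∀ c → ¬ Cycle adj c

_==_ : ∀ {m} → Fin m → Fin m → Bool
a == b = ⌊ a ≟ b ⌋

step : ∀ {m} → Adjacency m → Subset m → Subset m
step {m} A S = tabulate λ y →
  lookup S y ∨ foldr _∨_ false (map (λ x → lookup S x ∧ A x y) (allFin m))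

iter : ∀ {m} → ℕ → Adjacency m → Subset m → Subset m
iter zero    A S = S
iter (suc k) A S = step A (iter k A S)

component : ∀ {m} → Adjacency m → Fin m → Subset m
component {m} A a = iter m A ⁅ a ⁆

deleteVertex : ∀ {m} → Adjacency m → Fin m → Adjacency m
deleteVertex A v x y = A x y ∧ not (x == v) ∧ not (y == v)

deleteEdge : ∀ {m} → Adjacency m → Fin m → Fin m → Adjacency m
deleteEdge A a b x y = A x y ∧ not ((x == a ∧ y == b) ∨ (x == b ∧ y == a))

record TreeDecomposition {n : ℕ} (M : Matroid n) : Set where
  field
    T : Tree
    τ : Fin n → Fin (Tree.nV T)

module _ {n : ℕ} {M : Matroid n} (D : TreeDecomposition M) where
  open TreeDecomposition D
  open Tree T

  preimage : Subset nV → Subset n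
  preimage S = tabulate λ e → lookup S (τ e)

  -- u is the least vertex of its component in T - v (one representative
  -- per component of T - v)
  isRep : Fin nV → Fin nV → Bool
  isRep v u = not (u == v) ∧
    not (foldr _∨_ false (map (λ w → ⌊ w <? u ⌋ ∧ lookup (component (deleteVertex adj v) u) w)
                               (allFin nV)))

  nodeWidth : Fin nV → ℕ
  nodeWidth v = rM M ∸ sum (map (λ u → if isRep v u
                                        then rd M (preimage (component (deleteVertex adj v) u))
                                        else 0)
                                (allFin nV))

  width : ℕ
  width = foldr _⊔_ 0 (map nodeWidth (allFin nV))

  displayedU : Fin nV → Fin nV → Subset n
  displayedU a b = preimage (component (deleteEdge adj a b) a)

  displayedW : Fin nV → Fin nV → Subset n
  displayedW a b = preimage (component (deleteEdge adj a b) b)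

  numVertices : ℕ
  numVertices = nV

IsTreeWidth : ∀ {n} → Matroid n → ℕ → Set
IsTreeWidth M k = ∃ (λ (D : TreeDecomposition M) → width D ≡ k)
                × (∀ (D : TreeDecomposition M) → k ≤ width D)

IsGood : ∀ {n} (M : Matroid n) → ℕ → TreeDecomposition M → Set
IsGood M k D = width D ≡ k
             × (∀ (D' : TreeDecomposition M) → width D' ≡ k → numVertices D ≤ numVertices D')

-- Suppose an edge ab displays a set U with r(U) = r(M). Walking from a through b without
-- backtracking ends at a leaf ℓ of T, with neighbour p, on b's side of ab; no element at ℓ
-- lies in U, so E − τ⁻¹(ℓ) spans M and the component {ℓ} of T − p has rank defect 0.
-- Delete ℓ and move its elements to p. At every vertex each component of positive defect
-- lies inside a component of the new tree with at least that defect, and distinct ones stay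
-- distinct, so no node width grows: the result has width tw(M) and fewer vertices.

module Submission where

open import Defs
import Data.Nat.Properties as ℕP
open import Algebra.Properties.CommutativeSemigroup ℕP.+-commutativeSemigroup using (x∙yz≈y∙xz)
open import Data.Bool using (Bool; true; false; _∧_; _∨_; not; if_then_else_)
open import Data.Bool.ListAction using (any)
import Data.Bool.Properties as Bool
open import Data.Bool.Properties using (T-≡; ∧-conicalˡ; ∧-conicalʳ; ∧-comm; ∨-comm; ∧-zeroʳ; ∧-identityʳ; ∨-zeroʳ)
open import Data.Empty using (⊥-elim)
open import Data.Fin using (Fin; zero; suc; _<_; _<?_; punchIn; punchOut)
import Data.Fin.Induction as FinInd
import Data.Fin.Properties as FinP
open import Data.Fin.Properties using (suc-injective; _≟_; punchInᵢ≢i; punchOut-cong; punchOut-punchIn; punchIn-punchOut)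
open import Data.Fin.Subset using (Subset; ⁅_⁆; _⊆_; ∁)
open import Data.Fin.Subset.Properties using (x∈⁅x⁆; x∈⁅y⁆⇒x≡y; p⊆q⇒∁p⊇∁q; x∉p⇒x∈∁p)
open import Data.List using (List; []; _∷_; _++_; length; map; foldr; allFin; tabulate)
open import Data.List.Membership.Propositional using (lose) renaming (_∈_ to _∈ₗ_)
open import Data.List.Membership.Propositional.Properties using (∈-allFin; ∈-∃++)
import Data.List.Properties as ListP
open import Data.List.Properties using (map-tabulate; length-map; map-++)
open import Data.List.Relation.Unary.All using (All; []; _∷_)
open import Data.List.Relation.Unary.All.Properties using (¬Any⇒All¬; ++⁺; ++⁻ˡ; ++⁻ʳ)
open import Data.List.Relation.Unary.Any using (here; there; satisfied; any?)
open import Data.List.Relation.Unary.Any.Properties using (any⁺; any⁻)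
open import Data.List.Relation.Unary.Unique.Propositional using (Unique; []; _∷_)
import Data.List.Relation.Unary.Unique.Propositional.Properties as Unique
open import Data.Nat as ℕ using (ℕ; _+_; _∸_; _≤_; _⊔_; z≤n; s≤s) renaming (_<_ to _<ℕ_)
open import Data.Nat.ListAction using (sum)
open import Data.Product using (∃; _×_; _,_; proj₁; proj₂)
open import Data.Sum using (_⊎_; inj₁; inj₂)
open import Data.Unit using (tt)
open import Data.Vec using (lookup)
import Data.Vec.Properties as VecP
open import Data.Vec.Properties using (lookup∘tabulate; []=⇒lookup; lookup⇒[]=)
open import Function using (_∘_; id; case_of_; Equivalence)
open import Induction.WellFounded using (Acc; acc)
open import Relation.Binary using (tri<; tri≈; tri>)
open import Relation.Binary.Construct.Closure.ReflexiveTransitive as Star using (Star; ε; _◅_; _◅◅_)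
open import Relation.Binary.PropositionalEquality
open import Relation.Nullary using (¬_; yes; no)
open import Relation.Nullary.Decidable
  using (isYes≗does; dec-true; dec-false; ¬?; _×-dec_; decidable-stable; toWitness; ⌊_⌋)

∨-true⁻ : ∀ x {y} → x ∨ y ≡ true → x ≡ true ⊎ y ≡ true
∨-true⁻ true  _ = inj₁ refl
∨-true⁻ false e = inj₂ e

any-true⁻ : ∀ {A : Set} (h : A → Bool) xs → any h xs ≡ true → ∃ λ x → h x ≡ true
any-true⁻ h xs e with x , hx ← satisfied (any⁻ h xs (Equivalence.from T-≡ e)) = x , Equivalence.to T-≡ hx

any-true⁺ : ∀ {A : Set} (h : A → Bool) {x xs} → x ∈ₗ xs → h x ≡ true → any h xs ≡ true
any-true⁺ h x∈xs hx = Equivalence.to T-≡ (any⁺ h (lose x∈xs (Equivalence.from T-≡ hx)))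

∑ : ∀ n → (Fin n → ℕ) → ℕ
∑ ℕ.zero    f = 0
∑ (ℕ.suc n) f = f zero + ∑ n (f ∘ suc)

sum-map-allFin : ∀ n (f : Fin n → ℕ) → sum (map f (allFin n)) ≡ ∑ n f
sum-map-allFin n f = trans (cong sum (map-tabulate id f)) (sum-tabulate n f)
  where
  sum-tabulate : ∀ n (f : Fin n → ℕ) → sum (tabulate f) ≡ ∑ n f
  sum-tabulate ℕ.zero    f = refl
  sum-tabulate (ℕ.suc n) f = cong (f zero +_) (sum-tabulate n (f ∘ suc))

erase : ∀ {n} → Fin n → (Fin n → ℕ) → Fin n → ℕ
erase zero    f zero    = 0
erase zero    f (suc y) = f (suc y)
erase (suc x) f zero    = f zero
erase (suc x) f (suc y) = erase x (f ∘ suc) y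

erase-≢ : ∀ {n} (x : Fin n) f {y} → y ≢ x → erase x f y ≡ f y
erase-≢ zero    f {zero}  y≢x = ⊥-elim (y≢x refl)
erase-≢ zero    f {suc y} y≢x = refl
erase-≢ (suc x) f {zero}  y≢x = refl
erase-≢ (suc x) f {suc y} y≢x = erase-≢ x (f ∘ suc) (y≢x ∘ cong suc)

∑-erase : ∀ n (f : Fin n → ℕ) x → ∑ n f ≡ f x + ∑ n (erase x f)
∑-erase (ℕ.suc n) f zero    = refl
∑-erase (ℕ.suc n) f (suc x) =
  trans (cong (f zero +_) (∑-erase n (f ∘ suc) x)) (x∙yz≈y∙xz (f zero) (f (suc x)) _)

sum-map-unique-≤ : ∀ {n} (f : Fin n → ℕ) {xs} → Unique xs → sum (map f xs) ≤ ∑ n f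
sum-map-unique-≤ f {[]}     []            = z≤n
sum-map-unique-≤ {n} f {x ∷ xs} (x∉xs ∷ xs!) = begin
  f x + sum (map f xs)           ≡⟨ cong (f x +_) (sum-map-erase x∉xs) ⟨
  f x + sum (map (erase x f) xs) ≤⟨ ℕP.+-monoʳ-≤ (f x) (sum-map-unique-≤ (erase x f) xs!) ⟩
  f x + ∑ n (erase x f)          ≡⟨ ∑-erase n f x ⟨
  ∑ n f                          ∎
  where
  open ℕP.≤-Reasoning
  sum-map-erase : ∀ {ys} → All (x ≢_) ys → sum (map (erase x f) ys) ≡ sum (map f ys)
  sum-map-erase []           = refl
  sum-map-erase (x≢y ∷ x∉ys) = cong₂ _+_ (erase-≢ x f (x≢y ∘ sym)) (sum-map-erase x∉ys)

length-unique-≤ : ∀ {n} {xs : List (Fin n)} → Unique xs → length xs ≤ n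
length-unique-≤ {n} {xs} xs! =
  subst₂ _≤_ (sum-ones xs) (∑-ones n) (sum-map-unique-≤ (λ _ → 1) xs!)
  where
  sum-ones : ∀ (ys : List (Fin n)) → sum (map (λ _ → 1) ys) ≡ length ys
  sum-ones []       = refl
  sum-ones (_ ∷ ys) = cong ℕ.suc (sum-ones ys)
  ∑-ones : ∀ k → ∑ k (λ _ → 1) ≡ k
  ∑-ones ℕ.zero    = refl
  ∑-ones (ℕ.suc k) = cong ℕ.suc (∑-ones k)

∑-≤-injection : ∀ m {m′} (f : Fin m → ℕ) (g : Fin m′ → ℕ) (φ : ∀ u → f u ≢ 0 → Fin m′) →
  (∀ u fu≢0 → f u ≤ g (φ u fu≢0)) →
  (∀ u v fu≢0 fv≢0 → φ u fu≢0 ≡ φ v fv≢0 → u ≡ v) →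
  ∑ m f ≤ ∑ m′ g
∑-≤-injection ℕ.zero    f g φ bound inj = z≤n
∑-≤-injection (ℕ.suc m) {m′} f g φ bound inj with f zero ℕ.≟ 0
... | yes f₀≡0 = begin
  f zero + ∑ m (f ∘ suc) ≡⟨ cong (_+ ∑ m (f ∘ suc)) f₀≡0 ⟩
  ∑ m (f ∘ suc)          ≤⟨ ∑-≤-injection m (f ∘ suc) g (φ ∘ suc) (bound ∘ suc)
                              (λ u v fu fv → suc-injective ∘ inj (suc u) (suc v) fu fv) ⟩
  ∑ m′ g                 ∎
  where open ℕP.≤-Reasoning
... | no f₀≢0 = begin
  f zero + ∑ m (f ∘ suc)          ≤⟨ ℕP.+-mono-≤ (bound zero f₀≢0)
                                       (∑-≤-injection m (f ∘ suc) (erase y₀ g) (φ ∘ suc) bound′ inj′) ⟩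
  g y₀ + ∑ m′ (erase y₀ g)        ≡⟨ ∑-erase m′ g y₀ ⟨
  ∑ m′ g                          ∎
  where
  open ℕP.≤-Reasoning
  y₀ = φ zero f₀≢0
  bound′ : ∀ u fu≢0 → f (suc u) ≤ erase y₀ g (φ (suc u) fu≢0)
  bound′ u fu≢0 = subst (f (suc u) ≤_)
    (sym (erase-≢ y₀ g (λ eq → case inj (suc u) zero fu≢0 f₀≢0 eq of λ ())))
    (bound (suc u) fu≢0)
  inj′ : ∀ u v fu fv → φ (suc u) fu ≡ φ (suc v) fv → u ≡ v
  inj′ u v fu fv = suc-injective ∘ inj (suc u) (suc v) fu fv

==-refl : ∀ {n} (x : Fin n) → (x == x) ≡ true
==-refl x = trans (isYes≗does (x ≟ x)) (dec-true (x ≟ x) refl)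

==-≢ : ∀ {n} {x y : Fin n} → x ≢ y → (x == y) ≡ false
==-≢ {x = x} {y} x≢y = trans (isYes≗does (x ≟ y)) (dec-false (x ≟ y) x≢y)

Edge : ∀ {m} → Adjacency m → Fin m → Fin m → Set
Edge G x y = G x y ≡ true

Reach : ∀ {m} → Adjacency m → Fin m → Fin m → Set
Reach G = Star (Edge G)

Symmetric : ∀ {m} → Adjacency m → Set
Symmetric G = ∀ x y → G x y ≡ G y x

reach-sym : ∀ {m} {G : Adjacency m} → Symmetric G → ∀ {x y} → Reach G x y → Reach G y x
reach-sym G-sym = Star.reverse (λ {x} {y} e → trans (G-sym y x) e)

reach-cong : ∀ {m} {G H : Adjacency m} → (∀ x y → G x y ≡ H x y) → ∀ {x y} → Reach G x y → Reach H x y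
reach-cong G≗H = Star.map (λ {x} {y} e → trans (sym (G≗H x y)) e)

deleteVertex-⊆ : ∀ {m} (A : Adjacency m) v {x y} → Edge (deleteVertex A v) x y → Edge A x y
deleteVertex-⊆ A v {x} {y} = ∧-conicalˡ (A x y) _

deleteVertex-sym : ∀ {m} {A : Adjacency m} → Symmetric A → ∀ v → Symmetric (deleteVertex A v)
deleteVertex-sym {A = A} A-sym v x y rewrite A-sym x y = cong (A y x ∧_) (∧-comm (not (x == v)) _)

deleteVertex-avoids : ∀ {m} (A : Adjacency m) v {x y} → Edge (deleteVertex A v) x y → y ≢ v
deleteVertex-avoids A v {x} {y} e refl
  with () ← trans (sym (∧-conicalʳ (not (x == v)) _ (∧-conicalʳ (A x y) _ e))) (cong not (==-refl y))

deleteVertex-edge : ∀ {m} (A : Adjacency m) {v x y} → Edge A x y → x ≢ v → y ≢ v → Edge (deleteVertex A v) x y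
deleteVertex-edge A {x = x} {y} e x≢v y≢v rewrite ==-≢ x≢v | ==-≢ y≢v = trans (∧-identityʳ (A x y)) e

reach-avoids : ∀ {m} (A : Adjacency m) v {x y} → Reach (deleteVertex A v) x y → x ≢ v → y ≢ v
reach-avoids A v ε       x≢v = x≢v
reach-avoids A v (e ◅ r) _   = reach-avoids A v r (deleteVertex-avoids A v e)

deleteEdge-sym : ∀ {m} {A : Adjacency m} → Symmetric A → ∀ a b → Symmetric (deleteEdge A a b)
deleteEdge-sym {A = A} A-sym a b x y rewrite A-sym x y =
  cong (λ t → A y x ∧ not t)
    (trans (∨-comm (x == a ∧ y == b) _) (cong₂ _∨_ (∧-comm (x == b) _) (∧-comm (x == a) _)))

deleteEdge-comm : ∀ {m} (A : Adjacency m) a b x y → deleteEdge A b a x y ≡ deleteEdge A a b x y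
deleteEdge-comm A a b x y = cong (λ t → A x y ∧ not t) (∨-comm (x == b ∧ y == a) _)

deleteEdge-⊆ : ∀ {m} (A : Adjacency m) a b {x y} → Edge (deleteEdge A a b) x y → Edge A x y
deleteEdge-⊆ A a b {x} {y} = ∧-conicalˡ (A x y) _

deleteEdge-removes : ∀ {m} (A : Adjacency m) {a b} → a ≢ b → deleteEdge A a b b a ≡ false
deleteEdge-removes A {a} {b} a≢b
  rewrite ==-≢ (a≢b ∘ sym) | ==-refl a | ==-refl b = ∧-zeroʳ (A b a)

deleteEdge-away : ∀ {m} (A : Adjacency m) {a b} x {y} → y ≢ a → y ≢ b → deleteEdge A a b x y ≡ A x y
deleteEdge-away A {a} {b} x {y} y≢a y≢b
  rewrite ==-≢ y≢a | ==-≢ y≢b | ∧-zeroʳ (x == a) | ∧-zeroʳ (x == b) = ∧-identityʳ (A x y)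

module _ {m} {G : Adjacency m} where

  vertices : ∀ {x y} → Reach G x y → List (Fin m)
  vertices {x} ε       = x ∷ []
  vertices {x} (_ ◅ r) = x ∷ vertices r

  vertices-nonempty : ∀ {x y} (r : Reach G x y) → 1 ≤ length (vertices r)
  vertices-nonempty ε       = s≤s z≤n
  vertices-nonempty (_ ◅ _) = s≤s z≤n

  SimplePath : Fin m → Fin m → Set
  SimplePath x y = ∃ λ (r : Reach G x y) → Unique (vertices r)

  suffix : ∀ {x y z} (r : Reach G x y) → Unique (vertices r) → z ∈ₗ vertices r → SimplePath z y
  suffix ε       r!       (here refl) = ε , r!
  suffix (e ◅ r) r!       (here refl) = e ◅ r , r!
  suffix (e ◅ r) (_ ∷ r!) (there z∈r) = suffix r r! z∈r

  simplePath : ∀ {x y} → Reach G x y → SimplePath x y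
  simplePath ε = ε , [] ∷ []
  simplePath {x} (e ◅ r) with s , s! ← simplePath r | any? (x ≟_) (vertices s)
  ... | yes x∈s = suffix s s! x∈s
  ... | no  x∉s = e ◅ s , ¬Any⇒All¬ _ x∉s ∷ s!

  walk-vertices : ∀ {A : Adjacency m} → (∀ {u w} → Edge G u w → Edge A u w) →
    ∀ {x y z} (r : Reach G x y) → Edge A y z → Walk A (vertices r ++ z ∷ [])
  walk-vertices G⊆A ε             e = e , tt
  walk-vertices G⊆A (g ◅ ε)       e = G⊆A g , e , tt
  walk-vertices G⊆A (g ◅ r@(_ ◅ _)) e = G⊆A g , walk-vertices G⊆A r e

  walk⇒reach : ∀ x y xs → Walk G (x ∷ xs ++ y ∷ []) → Reach G x y
  walk⇒reach x y []       (e , _) = e ◅ ε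
  walk⇒reach x y (z ∷ xs) (e , w) = e ◅ walk⇒reach z y xs w

  reach⇒walk : ∀ {x y} → Reach G x y → x ≡ y ⊎ ∃ λ xs → Walk G (x ∷ xs ++ y ∷ [])
  reach⇒walk ε = inj₁ refl
  reach⇒walk (e ◅ r) with reach⇒walk r
  ... | inj₁ refl    = inj₂ ([] , e , tt)
  ... | inj₂ (xs , w) = inj₂ (_ ∷ xs , e , w)

module _ {m} (G : Adjacency m) where

  lookup-step : ∀ S y → lookup (step G S) y ≡ (lookup S y ∨ any (λ x → lookup S x ∧ G x y) (allFin m))
  lookup-step S y = lookup∘tabulate _ y

  iter-sound : ∀ k {a S} → (∀ {y} → lookup S y ≡ true → Reach G a y) →
    ∀ {y} → lookup (iter k G S) y ≡ true → Reach G a y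
  iter-sound ℕ.zero    S⊆ = S⊆
  iter-sound (ℕ.suc k) {S = S} S⊆ {y} e
    with ∨-true⁻ (lookup (iter k G S) y) (trans (sym (lookup-step (iter k G S) y)) e)
  ... | inj₁ y∈ = iter-sound k S⊆ y∈
  ... | inj₂ y∈ with x , x∈∧xy ← any-true⁻ (λ x → lookup (iter k G S) x ∧ G x y) (allFin m) y∈ =
    iter-sound k S⊆ (∧-conicalˡ _ (G x y) x∈∧xy) ◅◅ ∧-conicalʳ (lookup (iter k G S) x) _ x∈∧xy ◅ ε

  module _ {S : Subset m} where

    iter-grows : ∀ k {x} → lookup (iter k G S) x ≡ true → lookup (iter (ℕ.suc k) G S) x ≡ true
    iter-grows k {x} e = trans (lookup-step (iter k G S) x)
      (cong (_∨ any (λ z → lookup (iter k G S) z ∧ G z x) (allFin m)) e)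

    iter-+ : ∀ j k {x} → lookup (iter k G S) x ≡ true → lookup (iter (j + k) G S) x ≡ true
    iter-+ ℕ.zero    k e = e
    iter-+ (ℕ.suc j) k e = iter-grows (j + k) (iter-+ j k e)

    iter-edge : ∀ k {x y} → lookup (iter k G S) x ≡ true → Edge G x y → lookup (iter (ℕ.suc k) G S) y ≡ true
    iter-edge k {x} {y} x∈ xy = trans (lookup-step (iter k G S) y)
      (trans (cong (lookup (iter k G S) y ∨_)
                   (any-true⁺ (λ z → lookup (iter k G S) z ∧ G z y) (∈-allFin x) (cong₂ _∧_ x∈ xy)))
             (∨-zeroʳ _))

    iter-reach : ∀ k {x y} (r : Reach G x y) →
      lookup (iter k G S) x ≡ true → lookup (iter (length (vertices r) + k) G S) y ≡ true
    iter-reach k ε       x∈ = iter-grows k x∈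
    iter-reach k {y = y} (xz ◅ r) x∈ =
      subst (λ j → lookup (iter j G S) y ≡ true) (ℕP.+-suc (length (vertices r)) k)
        (iter-reach (ℕ.suc k) r (iter-edge k x∈ xz))

  component-sound : ∀ {a y} → lookup (component G a) y ≡ true → Reach G a y
  component-sound {a} = iter-sound m (λ e → subst (Reach G a) (sym (x∈⁅y⁆⇒x≡y a (lookup⇒[]= _ _ e))) ε)

  component-cong : ∀ {H : Adjacency m} → (∀ x y → G x y ≡ H x y) → ∀ a → component G a ≡ component H a
  component-cong {H} G≗H a = iter-cong m
    where
    iter-cong : ∀ k → iter k G ⁅ a ⁆ ≡ iter k H ⁅ a ⁆
    iter-cong ℕ.zero    = refl
    iter-cong (ℕ.suc k) rewrite iter-cong k = VecP.tabulate-cong λ y →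
      cong (lookup (iter k H ⁅ a ⁆) y ∨_)
        (cong (foldr _∨_ false) (ListP.map-cong (λ x → cong (lookup (iter k H ⁅ a ⁆) x ∧_) (G≗H x y)) (allFin m)))

  -- A simple path has at most m vertices, so m rounds of the search suffice.
  component-complete : ∀ {a y} → Reach G a y → lookup (component G a) y ≡ true
  component-complete {a} {y} r with s , s! ← simplePath r =
    subst (λ j → lookup (iter j G ⁅ a ⁆) y ≡ true) (ℕP.m∸n+n≡m L≤m)
      (iter-+ (m ∸ L) L (subst (λ j → lookup (iter j G ⁅ a ⁆) y ≡ true) (ℕP.+-identityʳ L)
        (iter-reach 0 s ([]=⇒lookup (x∈⁅x⁆ a)))))
    where
    L = length (vertices s)
    L≤m : L ≤ m
    L≤m = length-unique-≤ s!

unique-prefix : ∀ {A : Set} xs {y : A} {ys} → Unique (xs ++ y ∷ ys) → Unique (xs ++ y ∷ [])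
unique-prefix []       (_ ∷ _)   = [] ∷ []
unique-prefix (x ∷ xs) (x∉ ∷ xs!) with x≢y ∷ _ ← ++⁻ʳ xs x∉ =
  ++⁺ (++⁻ˡ xs x∉) (x≢y ∷ []) ∷ unique-prefix xs xs!

walk-close : ∀ {m} {A : Adjacency m} xs y {ys} z →
  Walk A (xs ++ y ∷ ys) → Edge A y z → Walk A ((xs ++ y ∷ []) ++ z ∷ [])
walk-close []           y z _       yz = yz , tt
walk-close (x ∷ [])     y z (e , w) yz = e , walk-close [] y z w yz
walk-close (x ∷ x′ ∷ xs) y z (e , w) yz = e , walk-close (x′ ∷ xs) y z w yz

walk-map : ∀ {k m} {A : Adjacency m} (f : Fin k → Fin m) xs → Walk (λ x y → A (f x) (f y)) xs → Walk A (map f xs)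
walk-map f []           _       = tt
walk-map f (_ ∷ [])     _       = tt
walk-map f (_ ∷ y ∷ xs) (e , w) = e , walk-map f (y ∷ xs) w

1≤length-snoc : ∀ {A : Set} (xs : List A) x → 1 ≤ length (xs ++ x ∷ [])
1≤length-snoc []      _ = s≤s z≤n
1≤length-snoc (_ ∷ _) _ = s≤s z≤n

Pendant : ∀ {m} → Adjacency m → Fin m → Fin m → Set
Pendant A ℓ p = Edge A ℓ p × (∀ {w} → Edge A ℓ w → w ≡ p)

pendant-isolated : ∀ {m} {A : Adjacency m} {ℓ p w} → Pendant A ℓ p → Reach (deleteVertex A p) ℓ w → w ≡ ℓ
pendant-isolated             _              ε       = refl
pendant-isolated {A = A} {p = p} (_ , only-p) (e ◅ _) = ⊥-elim (deleteVertex-avoids A p e (only-p (deleteVertex-⊆ A p e)))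

module _ (T : Tree) where
  open Tree T

  edge-irreflexive : ∀ {x y} → Edge adj x y → x ≢ y
  edge-irreflexive {x} e refl with () ← trans (sym e) (irreflex x)

  reach-all : ∀ x y → Reach adj x y
  reach-all x y with connected x y
  ... | inj₁ refl      = ε
  ... | inj₂ (xs , w) = walk⇒reach x y xs w

  edge-separates : ∀ {a b} → Edge adj a b → ¬ Reach (deleteEdge adj a b) b a
  edge-separates {a} {b} ab r with simplePath r
  ... | ε , _ = edge-irreflexive ab refl
  ... | ba ◅ ε , _ with () ← trans (sym ba) (deleteEdge-removes adj (edge-irreflexive ab))
  ... | ba ◅ r′@(_ ◅ r″) , r! =
    acyclic (b ∷ vertices r′) (s≤s (vertices-nonempty r″) , r! , walk-vertices (deleteEdge-⊆ adj a b) (ba ◅ r′) ab)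

  -- Walk away from a through b, never backtracking: by acyclicity no vertex repeats,
  -- so the walk gets stuck, and it can only get stuck at a leaf.
  leaf-beyond : ∀ {a b} → Edge adj a b → ∃ λ ℓ → ∃ λ p → Pendant adj ℓ p × ¬ Reach (deleteEdge adj a b) a ℓ
  leaf-beyond {a} {b} ab =
    extend nV b a [] (ℕP.m<n+m nV (s≤s z≤n)) (((edge-irreflexive ab ∘ sym) ∷ []) ∷ [] ∷ [])
      (trans (symmetric b a) ab , tt) (there (here refl)) (here refl) ε
    where
    Gab = deleteEdge adj a b

    extend : ∀ fuel z y ys → nV <ℕ length (z ∷ y ∷ ys) + fuel → Unique (z ∷ y ∷ ys) → Walk adj (z ∷ y ∷ ys) →
      a ∈ₗ z ∷ y ∷ ys → b ∈ₗ z ∷ y ∷ ys → Reach Gab b z →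
      ∃ λ ℓ → ∃ λ p → Pendant adj ℓ p × ¬ Reach Gab a ℓ
    extend fuel z y ys bound path! (zy , walk) a∈ b∈ bz
      with FinP.any? (λ w → (adj z w Bool.≟ true) ×-dec ¬? (w ≟ y))
    ... | no stuck = z , y , (zy , λ {w} zw → decidable-stable (w ≟ y) (λ w≢y → stuck (w , zw , w≢y))) ,
                     λ az → edge-separates ab (bz ◅◅ reach-sym (deleteEdge-sym symmetric a b) az)
    ... | yes (w , zw , w≢y) with any? (w ≟_) (z ∷ y ∷ ys)
    ...   | yes (here w≡z)         = ⊥-elim (edge-irreflexive zw (sym w≡z))
    ...   | yes (there (here w≡y)) = ⊥-elim (w≢y w≡y)
    ...   | yes (there (there w∈ys)) with ys₁ , ys₂ , refl ← ∈-∃++ w∈ys =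
      ⊥-elim (acyclic (z ∷ y ∷ ys₁ ++ w ∷ [])
        (s≤s (1≤length-snoc ys₁ w) , unique-prefix (z ∷ y ∷ ys₁) path! ,
         walk-close (z ∷ y ∷ ys₁) w z (zy , walk) (trans (symmetric w z) zw)))
    extend ℕ.zero z y ys bound path! _ _ _ _ | yes _ | no _ =
      ⊥-elim (ℕP.<⇒≱ (subst (nV <ℕ_) (ℕP.+-identityʳ _) bound) (length-unique-≤ path!))
    extend (ℕ.suc fuel) z y ys bound path! (zy , walk) a∈ b∈ bz | yes (w , zw , _) | no w∉ =
      extend fuel w z (y ∷ ys) (subst (nV <ℕ_) (ℕP.+-suc _ fuel) bound) (¬Any⇒All¬ _ w∉ ∷ path!)
        (trans (symmetric w z) zw , zy , walk) (there a∈) (there b∈)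
        (bz ◅◅ trans (deleteEdge-away adj z (λ { refl → w∉ a∈ }) (λ { refl → w∉ b∈ })) zw ◅ ε)

rd-mono : ∀ {n} (M : Matroid n) {X Y : Subset n} → X ⊆ Y → rd M X ≤ rd M Y
rd-mono M X⊆Y = ℕP.∸-monoʳ-≤ (rM M) (Matroid.R2 M _ _ (p⊆q⇒∁p⊇∁q X⊆Y))

foldr-⊔-≤ : ∀ {A : Set} (f : A → ℕ) {k} xs → (∀ x → f x ≤ k) → foldr _⊔_ 0 (map f xs) ≤ k
foldr-⊔-≤ f []       _   = z≤n
foldr-⊔-≤ f (x ∷ xs) f≤k = ℕP.⊔-lub (f≤k x) (foldr-⊔-≤ f xs f≤k)

≤-foldr-⊔ : ∀ {A : Set} (f : A → ℕ) {x xs} → x ∈ₗ xs → f x ≤ foldr _⊔_ 0 (map f xs)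
≤-foldr-⊔ f         (here refl) = ℕP.m≤m⊔n _ _
≤-foldr-⊔ f {xs = y ∷ _} (there x∈) = ℕP.≤-trans (≤-foldr-⊔ f x∈) (ℕP.m≤n⊔m (f y) _)

module _ {n} {M : Matroid n} (D : TreeDecomposition M) where
  open TreeDecomposition D
  open Tree T

  lookup-preimage : ∀ S e → lookup (preimage D S) e ≡ lookup S (τ e)
  lookup-preimage S e = lookup∘tabulate (λ e → lookup S (τ e)) e

  branchSet : Fin nV → Fin nV → Subset n
  branchSet v u = preimage D (component (deleteVertex adj v) u)

  branchDefect : Fin nV → Fin nV → ℕ
  branchDefect v u = if isRep D v u then rd M (branchSet v u) else 0

  branchDefect-rep : ∀ {v u} → isRep D v u ≡ true → branchDefect v u ≡ rd M (branchSet v u)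
  branchDefect-rep rep rewrite rep = refl

  nonzero-rep : ∀ {v u} → branchDefect v u ≢ 0 → isRep D v u ≡ true
  nonzero-rep {v} {u} nonzero with isRep D v u
  ... | true  = refl
  ... | false = ⊥-elim (nonzero refl)

  isRep-sound : ∀ {v u} → isRep D v u ≡ true →
    u ≢ v × (∀ {w} → lookup (component (deleteVertex adj v) u) w ≡ true → ¬ w < u)
  isRep-sound {v} {u} rep = u≢v , minimal
    where
    u≢v : u ≢ v
    u≢v refl with () ← trans (sym (∧-conicalˡ _ _ rep)) (cong not (==-refl u))
    minimal : ∀ {w} → lookup (component (deleteVertex adj v) u) w ≡ true → ¬ w < u
    minimal {w} w∈ w<u with () ← trans (sym (∧-conicalʳ (not (u == v)) _ rep))
      (cong not (any-true⁺ (λ w → ⌊ w <? u ⌋ ∧ lookup (component (deleteVertex adj v) u) w) (∈-allFin w)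
        (cong₂ _∧_ (trans (isYes≗does (w <? u)) (dec-true (w <? u) w<u)) w∈)))

  isRep-smaller : ∀ {v u} → u ≢ v → isRep D v u ≡ false →
    ∃ λ w → w < u × lookup (component (deleteVertex adj v) u) w ≡ true
  isRep-smaller {v} {u} u≢v not-rep rewrite ==-≢ u≢v
    with w , w<u∧w∈ ← any-true⁻ _ (allFin nV) (Bool.not-injective not-rep) =
    w , toWitness {a? = w <? u} (Equivalence.from T-≡ (∧-conicalˡ _ _ w<u∧w∈)) , ∧-conicalʳ ⌊ w <? u ⌋ _ w<u∧w∈

  isRep-unique : ∀ {v u₁ u₂} → isRep D v u₁ ≡ true → isRep D v u₂ ≡ true →
    Reach (deleteVertex adj v) u₁ u₂ → u₁ ≡ u₂
  isRep-unique {v} {u₁} {u₂} rep₁ rep₂ r with FinP.<-cmp u₁ u₂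
  ... | tri≈ _ u₁≡u₂ _ = u₁≡u₂
  ... | tri< u₁<u₂ _ _ = ⊥-elim (proj₂ (isRep-sound rep₂)
          (component-complete _ (reach-sym (deleteVertex-sym symmetric v) r)) u₁<u₂)
  ... | tri> _ _ u₂<u₁ = ⊥-elim (proj₂ (isRep-sound rep₁) (component-complete _ r) u₂<u₁)

  rep-reachable : ∀ {v} x → x ≢ v → ∃ λ u → isRep D v u ≡ true × Reach (deleteVertex adj v) x u
  rep-reachable {v} x = descend x (FinInd.<-wellFounded x)
    where
    descend : ∀ x → Acc _<_ x → x ≢ v → ∃ λ u → isRep D v u ≡ true × Reach (deleteVertex adj v) x u
    descend x (acc smaller) x≢v with isRep D v x in rep
    ... | true  = x , rep , ε
    ... | false with w , w<x , w∈ ← isRep-smaller x≢v rep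
      with xw ← component-sound _ w∈
      with u , u-rep , wu ← descend w (smaller w<x) (reach-avoids adj v xw x≢v) =
      u , u-rep , xw ◅◅ wu

  nodeWidth-∑ : ∀ v → nodeWidth D v ≡ rM M ∸ ∑ nV (branchDefect v)
  nodeWidth-∑ v = cong (rM M ∸_) (sum-map-allFin nV (branchDefect v))

module _ {n} {M : Matroid n} (D D′ : TreeDecomposition M) where

  nodeWidth-mono : ∀ {v v′} (φ : ∀ u → branchDefect D v u ≢ 0 → Fin (numVertices D′)) →
    (∀ u nz → isRep D′ v′ (φ u nz) ≡ true × branchSet D v u ⊆ branchSet D′ v′ (φ u nz)) →
    (∀ u₁ u₂ nz₁ nz₂ → φ u₁ nz₁ ≡ φ u₂ nz₂ → u₁ ≡ u₂) →
    nodeWidth D′ v′ ≤ nodeWidth D v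
  nodeWidth-mono {v} {v′} φ dominated injective =
    subst₂ _≤_ (sym (nodeWidth-∑ D′ v′)) (sym (nodeWidth-∑ D v))
      (ℕP.∸-monoʳ-≤ (rM M) (∑-≤-injection _ _ _ φ bound injective))
    where
    bound : ∀ u nz → branchDefect D v u ≤ branchDefect D′ v′ (φ u nz)
    bound u nz with rep′ , B⊆B′ ← dominated u nz =
      subst₂ _≤_ (sym (branchDefect-rep D (nonzero-rep D nz))) (sym (branchDefect-rep D′ rep′)) (rd-mono M B⊆B′)

  width-mono : (∀ v′ → ∃ λ v → nodeWidth D′ v′ ≤ nodeWidth D v) → width D′ ≤ width D
  width-mono dominated = foldr-⊔-≤ (nodeWidth D′) (allFin _) λ v′ →
    let v , le = dominated v′ in ℕP.≤-trans le (≤-foldr-⊔ (nodeWidth D) (∈-allFin v))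

preimage-⊆ : ∀ {n} {M : Matroid n} (D D′ : TreeDecomposition M) {S S′} →
  (∀ e → lookup S (TreeDecomposition.τ D e) ≡ true → lookup S′ (TreeDecomposition.τ D′ e) ≡ true) →
  preimage D S ⊆ preimage D′ S′
preimage-⊆ D D′ {S} {S′} h {e} e∈ = lookup⇒[]= e _
  (trans (lookup-preimage D′ S′ e) (h e (trans (sym (lookup-preimage D S e)) ([]=⇒lookup e∈))))

-- Fin m is identified with the vertices other than ℓ; ρ sends ℓ to (the copy of) p.
record VertexDeletion (k : ℕ) (ℓ p : Fin k) : Set where
  field
    m       : ℕ
    shrinks : m <ℕ k
    ι       : Fin m → Fin k
    ρ       : Fin k → Fin m
    ρ∘ι     : ∀ x → ρ (ι x) ≡ x
    ι∘ρ     : ∀ {x} → x ≢ ℓ → ι (ρ x) ≡ x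
    ρ-ℓ     : ρ ℓ ≡ ρ p

punchDeletion : ∀ {k} {ℓ p : Fin k} → ℓ ≢ p → VertexDeletion k ℓ p
punchDeletion {ℕ.suc m} {ℓ} {p} ℓ≢p = record
  { m       = m
  ; shrinks = ℕP.n<1+n m
  ; ι       = punchIn ℓ
  ; ρ       = ρ
  ; ρ∘ι     = ρ∘ι
  ; ι∘ρ     = ι∘ρ
  ; ρ-ℓ     = ρ-ℓ
  }
  where
  ρ : Fin (ℕ.suc m) → Fin m
  ρ x with x ≟ ℓ
  ... | yes _   = punchOut ℓ≢p
  ... | no x≢ℓ = punchOut (x≢ℓ ∘ sym)

  ρ∘ι : ∀ x → ρ (punchIn ℓ x) ≡ x
  ρ∘ι x with punchIn ℓ x ≟ ℓ
  ... | yes ιx≡ℓ = ⊥-elim (punchInᵢ≢i ℓ x ιx≡ℓ)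
  ... | no _     = trans (punchOut-cong ℓ refl) (punchOut-punchIn ℓ)

  ι∘ρ : ∀ {x} → x ≢ ℓ → punchIn ℓ (ρ x) ≡ x
  ι∘ρ {x} x≢ℓ with x ≟ ℓ
  ... | yes x≡ℓ = ⊥-elim (x≢ℓ x≡ℓ)
  ... | no _    = punchIn-punchOut _

  ρ-ℓ : ρ ℓ ≡ ρ p
  ρ-ℓ with ℓ ≟ ℓ | p ≟ ℓ
  ... | no ℓ≢ℓ | _       = ⊥-elim (ℓ≢ℓ refl)
  ... | yes _  | yes p≡ℓ = ⊥-elim (ℓ≢p (sym p≡ℓ))
  ... | yes _  | no _    = punchOut-cong ℓ refl

module PendantContraction {n} {M : Matroid n} (D : TreeDecomposition M)
  {ℓ p : Fin (numVertices D)} (pendant : Pendant (Tree.adj (TreeDecomposition.T D)) ℓ p)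
  (Δ : VertexDeletion (numVertices D) ℓ p) (leaf-defect : rd M (branchSet D p ℓ) ≡ 0) where

  open TreeDecomposition D
  open Tree T
  open VertexDeletion Δ

  p≢ℓ : p ≢ ℓ
  p≢ℓ = edge-irreflexive T (proj₁ pendant) ∘ sym

  ι-injective : ∀ {x y} → ι x ≡ ι y → x ≡ y
  ι-injective {x} {y} ιx≡ιy = trans (sym (ρ∘ι x)) (trans (cong ρ ιx≡ιy) (ρ∘ι y))

  ==-ι : ∀ x y → (ι x == ι y) ≡ (x == y)
  ==-ι x y with x ≟ y
  ... | yes refl = ==-refl (ι x)
  ... | no x≢y   = ==-≢ (x≢y ∘ ι-injective)

  restrict : Adjacency nV → Adjacency m
  restrict G x y = G (ι x) (ι y)

  reach-restrict : ∀ {G x y} → Reach (restrict G) x y → Reach G (ι x) (ι y)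
  reach-restrict = Star.gmap ι id

  -- The only edge at ℓ is ℓp, and ρ collapses it.
  contract-edge : ∀ {G} → (∀ {x y} → Edge G x y → Edge adj x y) →
    ∀ {x y} → Edge G x y → ρ x ≡ ρ y ⊎ Edge (restrict G) (ρ x) (ρ y)
  contract-edge {G} G⊆adj {x} {y} e with x ≟ ℓ | y ≟ ℓ
  ... | yes refl | _        = inj₁ (trans ρ-ℓ (cong ρ (sym (proj₂ pendant (G⊆adj e)))))
  ... | no _     | yes refl = inj₁ (trans (cong ρ (proj₂ pendant (trans (symmetric ℓ x) (G⊆adj e)))) (sym ρ-ℓ))
  ... | no x≢ℓ   | no y≢ℓ   = inj₂ (subst₂ (Edge G) (sym (ι∘ρ x≢ℓ)) (sym (ι∘ρ y≢ℓ)) e)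

  reach-contract : ∀ {G} → (∀ {x y} → Edge G x y → Edge adj x y) →
    ∀ {x y} → Reach G x y → Reach (restrict G) (ρ x) (ρ y)
  reach-contract {G} G⊆adj = Star.fold (λ x y → Reach (restrict G) (ρ x) (ρ y)) contract-step ε
    where
    contract-step : ∀ {x y z} → Edge G x y → Reach (restrict G) (ρ y) (ρ z) → Reach (restrict G) (ρ x) (ρ z)
    contract-step {z = z} e r with contract-edge G⊆adj e
    ... | inj₁ ρx≡ρy = subst (λ w → Reach (restrict G) w (ρ z)) (sym ρx≡ρy) r
    ... | inj₂ e′    = e′ ◅ r

  T′ : Tree
  T′ = record
    { nV        = m
    ; adj       = restrict adj
    ; nonempty  = ℕP.≤-trans (s≤s z≤n) (FinP.toℕ<n (ρ p))
    ; symmetric = λ x y → symmetric (ι x) (ι y)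
    ; irreflex  = λ x → irreflex (ι x)
    ; connected = λ x y → reach⇒walk (subst₂ (Reach (restrict adj)) (ρ∘ι x) (ρ∘ι y)
                            (reach-contract id (reach-all T (ι x) (ι y))))
    ; acyclic   = acyclic′
    }
    where
    acyclic′ : ∀ c → ¬ Cycle (restrict adj) c
    acyclic′ (x ∷ xs) (long , c! , closed) =
      acyclic (ι x ∷ map ι xs)
        ( subst (2 ≤_) (sym (length-map ι xs)) long
        , Unique.map⁺ ι-injective c!
        , subst (λ ys → Walk adj (ι x ∷ ys)) (map-++ ι xs (x ∷ [])) (walk-map ι (x ∷ xs ++ x ∷ []) closed))

  contracted : TreeDecomposition M
  contracted = record { T = T′ ; τ = ρ ∘ τ }

  module AtVertex (v′ : Fin m) where

    v : Fin nV
    v = ι v′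

    G  = deleteVertex adj v
    G′ = deleteVertex (restrict adj) v′

    G′≗restrict : ∀ x y → G′ x y ≡ restrict G x y
    G′≗restrict x y rewrite ==-ι x v′ | ==-ι y v′ = refl

    reach-down : ∀ {x y} → Reach G x y → Reach G′ (ρ x) (ρ y)
    reach-down = reach-cong (λ x y → sym (G′≗restrict x y)) ∘ reach-contract (deleteVertex-⊆ adj v)

    reach-up : ∀ {x y} → Reach G′ x y → Reach G (ι x) (ι y)
    reach-up = reach-restrict ∘ reach-cong G′≗restrict

    to-retract : ∀ {u} → u ≢ v → (u ≡ ℓ → p ≢ v) → Reach G u (ι (ρ u))
    to-retract {u} u≢v ℓ⇒p≢v with u ≟ ℓ
    ... | no u≢ℓ   = subst (Reach G u) (sym (ι∘ρ u≢ℓ)) ε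
    ... | yes refl = subst (Reach G ℓ) (sym (trans (cong ι ρ-ℓ) (ι∘ρ p≢ℓ)))
                       (deleteVertex-edge adj (proj₁ pendant) u≢v (ℓ⇒p≢v refl) ◅ ε)

    module _ {u} (nonzero : branchDefect D v u ≢ 0) where

      u-rep : isRep D v u ≡ true
      u-rep = nonzero-rep D nonzero

      u≢v : u ≢ v
      u≢v = proj₁ (isRep-sound D u-rep)

      -- For v = p the component {ℓ} of T − p carries no defect.
      u↝ρu : Reach G u (ι (ρ u))
      u↝ρu = to-retract u≢v λ u≡ℓ p≡v → nonzero (trans (branchDefect-rep D u-rep)
        (subst₂ (λ x y → rd M (branchSet D x y) ≡ 0) p≡v (sym u≡ℓ) leaf-defect))

      ρu≢v′ : ρ u ≢ v′
      ρu≢v′ ρu≡v′ = reach-avoids adj v u↝ρu u≢v (cong ι ρu≡v′)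

      φ : Fin m
      φ = proj₁ (rep-reachable contracted (ρ u) ρu≢v′)

      φ-rep : isRep contracted v′ φ ≡ true
      φ-rep = proj₁ (proj₂ (rep-reachable contracted (ρ u) ρu≢v′))

      ρu↝φ : Reach G′ (ρ u) φ
      ρu↝φ = proj₂ (proj₂ (rep-reachable contracted (ρ u) ρu≢v′))

      branch-⊆ : branchSet D v u ⊆ branchSet contracted v′ φ
      branch-⊆ = preimage-⊆ D contracted {component G u} {component G′ φ} λ e τe∈ → component-complete G′
        (reach-sym (deleteVertex-sym (Tree.symmetric T′) v′) ρu↝φ ◅◅ reach-down (component-sound G τe∈))

    φ-injective : ∀ {u₁ u₂} (nz₁ : branchDefect D v u₁ ≢ 0) (nz₂ : branchDefect D v u₂ ≢ 0) →
      φ nz₁ ≡ φ nz₂ → u₁ ≡ u₂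
    φ-injective nz₁ nz₂ φ≡φ = isRep-unique D (u-rep nz₁) (u-rep nz₂)
      (u↝ρu nz₁ ◅◅ reach-up (ρu↝φ nz₁ ◅◅ subst (λ w → Reach G′ w _) (sym φ≡φ)
        (reach-sym (deleteVertex-sym (Tree.symmetric T′) v′) (ρu↝φ nz₂)))
       ◅◅ reach-sym (deleteVertex-sym symmetric v) (u↝ρu nz₂))

    nodeWidth-≤ : nodeWidth contracted v′ ≤ nodeWidth D v
    nodeWidth-≤ = nodeWidth-mono D contracted (λ _ → φ) (λ _ nz → φ-rep nz , branch-⊆ nz)
      (λ _ _ → φ-injective)

  width-≤ : width contracted ≤ width D
  width-≤ = width-mono D contracted λ v′ → ι v′ , AtVertex.nodeWidth-≤ v′

disjoint-spanning⇒rd≡0 : ∀ {n} (M : Matroid n) {X B : Subset n} → X ⊆ ∁ B → Matroid.r M X ≡ rM M → rd M B ≡ 0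
disjoint-spanning⇒rd≡0 M X⊆∁B spans =
  ℕP.m≤n⇒m∸n≡0 (subst (_≤ Matroid.r M _) spans (Matroid.R2 M _ _ X⊆∁B))

contract-pendant : ∀ {n} {M : Matroid n} (D : TreeDecomposition M) {ℓ p} →
  Pendant (Tree.adj (TreeDecomposition.T D)) ℓ p → rd M (branchSet D p ℓ) ≡ 0 →
  ∃ λ D′ → width D′ ≤ width D × numVertices D′ <ℕ numVertices D
contract-pendant D pendant leaf-defect = contracted , width-≤ , shrinks
  where
  Δ = punchDeletion (edge-irreflexive (TreeDecomposition.T D) (proj₁ pendant))
  open PendantContraction D pendant Δ leaf-defect
  open VertexDeletion Δ using (shrinks)

-- Otherwise the leaf could be contracted away, giving a smaller decomposition of the same width.
spanning-meets-leaf : ∀ {n} {M : Matroid n} {k} → (∀ D′ → k ≤ width D′) →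
  ∀ {D : TreeDecomposition M} → IsGood M k D → ∀ {ℓ p} → Pendant (Tree.adj (TreeDecomposition.T D)) ℓ p →
  ∀ {X} → (∀ {e} → lookup X e ≡ true → TreeDecomposition.τ D e ≢ ℓ) → Matroid.r M X ≢ rM M
spanning-meets-leaf {M = M} lower {D} (width≡k , minimal) {ℓ} {p} pendant X-avoids spans =
  let D′ , width′≤ , smaller = contract-pendant D pendant (disjoint-spanning⇒rd≡0 M X⊆∁B spans)
  in ℕP.<⇒≱ smaller (minimal D′ (ℕP.≤-antisym (ℕP.≤-trans width′≤ (ℕP.≤-reflexive width≡k)) (lower D′)))
  where
  open TreeDecomposition D
  open Tree T
  X⊆∁B : _ ⊆ ∁ (branchSet D p ℓ)
  X⊆∁B {e} e∈X = x∉p⇒x∈∁p λ e∈B → X-avoids ([]=⇒lookup e∈X)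
    (pendant-isolated {A = adj} pendant (component-sound Gp (trans (sym (lookup-preimage D (component Gp ℓ) e)) ([]=⇒lookup e∈B))))
    where Gp = deleteVertex adj p

side-not-spanning : ∀ {n} {M : Matroid n} {k} → (∀ D′ → k ≤ width D′) →
  ∀ {D : TreeDecomposition M} → IsGood M k D → let open Tree (TreeDecomposition.T D) in
  ∀ {a b} → Edge adj a b → Matroid.r M (preimage D (component (deleteEdge adj a b) a)) ≢ rM M
side-not-spanning lower {D} good {a} {b} ab
  with ℓ , p , pendant , far ← leaf-beyond (TreeDecomposition.T D) ab =
  spanning-meets-leaf lower {D} good pendant λ {e} e∈ τe≡ℓ →
    far (subst (Reach Gab a) τe≡ℓ (component-sound Gab (trans (sym (lookup-preimage D (component Gab a) e)) e∈)))
  where Gab = deleteEdge (Tree.adj (TreeDecomposition.T D)) a b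

corollary3p2 : ∀ {n} (M : Matroid n) (k : ℕ) → IsTreeWidth M k →
    (D : TreeDecomposition M) → IsGood M k D →
    (a b : Fin (numVertices D)) → Tree.adj (TreeDecomposition.T D) a b ≡ true →
    (Matroid.r M (displayedU D a b) ≢ rM M) × (Matroid.r M (displayedW D a b) ≢ rM M)
corollary3p2 M k (_ , lower) D good a b ab =
  side-not-spanning lower {D} good ab ,
  subst (λ W → Matroid.r M W ≢ rM M) (cong (preimage D) (component-cong _ (deleteEdge-comm adj a b) b))
    (side-not-spanning lower {D} good (trans (symmetric b a) ab))
  where open Tree (TreeDecomposition.T D)
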